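{- Let $X=\{x_1,\dots,x_n\}$ be a cluster and $y$ a cluster variable of $\mathcal A(W)$. Then the rational function expressing $y$ in terms of $x_1,\dots,x_n$ is exactly the same as the rational function expressing $\tau y$ in terms of $\tau x_1,\dots,\tau x_n$. In particular, $\mathbf d(X,y)=\mathbf d(\tau X,\tau y)$ (with coordinates indexed correspondingly).
   Context: $\mathcal A(W)$ is the coefficient-free cluster algebra of a finite crystallographic type $W$ with Coxeter system $(W,S)$. For a reduced expression $c=(c_1,\dots,c_n)$ of a Coxeter element, $\mathcal Q_c$ is the Coxeter graph oriented according to the order of letters in $c$, and $X_c$ the cluster of the seed with quiver $\mathcal Q_c$. Rotation $\tau$ on cluster variables: if $y$ is the variable at vertex $i$ of the seed obtained from $(\mathcal Q_c,X_c)$ by mutations $\mu_{i_1},\dots,\mu_{i_r}$, then $\tau(y)$ is the variable at vertex $i$ of the seed obtained from $(\mathcal Q_c,X_c)$ by mutations $\mu_{c_1},\dots,\mu_{c_n},\mu_{i_1},\dots,\mu_{i_r}$ (this is independent of $c$); $\tau X=\{\tau x:x\in X\}$, which is again a cluster. D-vectors: for $y\notin X$, $y=F/(x_1^{d_1}\cdots x_n^{d_n})$ with $F$ polynomial not divisible by any $x_i$, $\mathbf d(X,y)=(d_1,\dots,d_n)$; $\mathbf d(X,x_i)=-e_i$. -}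

module Defs where

open import Data.Nat as ℕ using (ℕ; zero; suc)
open import Data.Integer as ℤ using (ℤ; +_; -[1+_]; 0ℤ)
open import Data.Rational as ℚ using (ℚ; 0ℚ; 1ℚ; Positive)
open import Data.Rational.Properties using (pos+pos⇒pos; pos*pos⇒pos; 1/pos⇒pos; pos⇒nonZero)
open import Data.Fin using (Fin; zero; suc; _≟_)
open import Data.List as List using (List; []; _∷_)
open import Data.Product using (Σ; _×_; _,_; proj₁; proj₂; ∃)
open import Data.Sum using (_⊎_)
open import Function.Definitions using (Injective)
open import Relation.Nullary using (¬_; yes; no)
open import Relation.Binary.PropositionalEquality using (_≡_; _≢_)

-- Positive rationals (the semifield in which all cluster variables,
-- viewed as subtraction-free rational functions, are evaluated).

record ℚ⁺ : Set where
  constructor mk⁺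
  field
    val : ℚ
    pos : Positive val
open ℚ⁺ public

_+⁺_ : ℚ⁺ → ℚ⁺ → ℚ⁺
mk⁺ p hp +⁺ mk⁺ q hq = mk⁺ (p ℚ.+ q) (pos+pos⇒pos p {{hp}} q {{hq}})

_*⁺_ : ℚ⁺ → ℚ⁺ → ℚ⁺
mk⁺ p hp *⁺ mk⁺ q hq = mk⁺ (p ℚ.* q) (pos*pos⇒pos p {{hp}} q {{hq}})

inv⁺ : ℚ⁺ → ℚ⁺
inv⁺ (mk⁺ p hp) = mk⁺ ((ℚ.1/ p) {{pos⇒nonZero p {{hp}}}}) (1/pos⇒pos p {{hp}})

one⁺ : ℚ⁺
one⁺ = mk⁺ 1ℚ _

pow⁺ : ℚ⁺ → ℕ → ℚ⁺
pow⁺ x zero    = one⁺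
pow⁺ x (suc k) = x *⁺ pow⁺ x k

prod⁺ : ∀ {n} → (Fin n → ℚ⁺) → ℚ⁺
prod⁺ {zero}  f = one⁺
prod⁺ {suc n} f = f zero *⁺ prod⁺ (λ i → f (suc i))

[_]₊ : ℤ → ℕ
[ + n ]₊      = n
[ -[1+ n ] ]₊ = 0

sumℤ : ∀ {n} → (Fin n → ℤ) → ℤ
sumℤ {zero}  f = 0ℤ
sumℤ {suc n} f = f zero ℤ.+ sumℤ (λ i → f (suc i))

record FiniteTypeCartan (n : ℕ) (A : Fin n → Fin n → ℤ) : Set where
  field
    diag     : ∀ i → A i i ≡ + 2
    offdiag  : ∀ i j → i ≢ j → A i j ℤ.≤ 0ℤ
    zeroSym  : ∀ i j → A i j ≡ 0ℤ → A j i ≡ 0ℤ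
    D        : Fin n → ℕ
    D-pos    : ∀ i → D i ≢ 0
    symmetr  : ∀ i j → + D i ℤ.* A i j ≡ + D j ℤ.* A j i
    posDef   : (v : Fin n → ℤ) → (Σ (Fin n) λ i → v i ≢ 0ℤ) →
               0ℤ ℤ.< sumℤ (λ i → sumℤ (λ j → v i ℤ.* + D i ℤ.* A i j ℤ.* v j))

-- Coxeter element: a word c = (c_1,…,c_n) (c k = letter in position k)
-- using every simple reflection exactly once.

IsCoxeterWord : ∀ {n} → (Fin n → Fin n) → Set
IsCoxeterWord c = Injective _≡_ _≡_ c

coxList : ∀ {n} → (Fin n → Fin n) → List (Fin n)
coxList c = List.tabulate c

-- B is the exchange matrix of the quiver Q_c: the Coxeter graph of A
-- oriented according to the order of letters in c (b_ij > 0 means an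
-- arrow i → j, of weight given by the Cartan entries).
IsQuiverQc : ∀ {n} → (Fin n → Fin n → ℤ) → (Fin n → Fin n) →
             (Fin n → Fin n → ℤ) → Set
IsQuiverQc {n} A c B =
  (∀ i → B i i ≡ 0ℤ) ×
  (∀ (k l : Fin n) → Data.Fin._<_ k l →
     (B (c k) (c l) ≡ ℤ.- A (c k) (c l)) × (B (c l) (c k) ≡ A (c l) (c k)))

-- Seeds and mutation (values in ℚ⁺, i.e. evaluation at a positive point)

Matrix : ℕ → Set
Matrix n = Fin n → Fin n → ℤ

Seed : ℕ → Set
Seed n = Matrix n × (Fin n → ℚ⁺)

mutMatrix : ∀ {n} → Fin n → Matrix n → Matrix n
mutMatrix k B i j with i ≟ k | j ≟ k
... | yes _ | _     = ℤ.- B i j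
... | no _  | yes _ = ℤ.- B i j
... | no _  | no _  = B i j ℤ.+ (+ [ B i k ]₊ ℤ.* + [ B k j ]₊)
                            ℤ.- (+ [ ℤ.- B i k ]₊ ℤ.* + [ ℤ.- B k j ]₊)

mutCluster : ∀ {n} → Fin n → Matrix n → (Fin n → ℚ⁺) → Fin n → ℚ⁺
mutCluster k B x j with j ≟ k
... | yes _ = (prod⁺ (λ i → pow⁺ (x i) [ B i k ]₊)
               +⁺ prod⁺ (λ i → pow⁺ (x i) [ ℤ.- B i k ]₊)) *⁺ inv⁺ (x k)
... | no _  = x j

mutSeed : ∀ {n} → Fin n → Seed n → Seed n
mutSeed k (B , x) = mutMatrix k B , mutCluster k B x

-- apply μ_{i_1} first, then μ_{i_2}, …
mutSeq : ∀ {n} → List (Fin n) → Seed n → Seed n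
mutSeq []       s = s
mutSeq (k ∷ ks) s = mutSeq ks (mutSeed k s)

-- The cluster of the seed μ_{i_r}…μ_{i_1}(B, X_c), as a function of
-- the values t of the initial cluster X_c (t ranges over ℚ⁺^n).
Cluster : ℕ → Set
Cluster n = (Fin n → ℚ⁺) → Fin n → ℚ⁺

Variable : ℕ → Set
Variable n = (Fin n → ℚ⁺) → ℚ⁺

clusterOf : ∀ {n} → Matrix n → List (Fin n) → Cluster n
clusterOf B w t = proj₂ (mutSeq w (B , t))

Poly : ℕ → Set
Poly n = List (ℤ × (Fin n → ℕ))

powℚ : ℚ → ℕ → ℚ
powℚ x zero    = 1ℚ
powℚ x (suc k) = x ℚ.* powℚ x k

prodℚ : ∀ {n} → (Fin n → ℚ) → ℚ
prodℚ {zero}  f = 1ℚ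
prodℚ {suc n} f = f zero ℚ.* prodℚ (λ i → f (suc i))

evalP : ∀ {n} → Poly n → (Fin n → ℚ) → ℚ
evalP []             u = 0ℚ
evalP ((a , e) ∷ ps) u =
  (a ℚ./ 1) ℚ.* prodℚ (λ i → powℚ (u i) (e i)) ℚ.+ evalP ps u

NonzeroPoly : ∀ {n} → Poly n → Set
NonzeroPoly {n} Q = Σ (Fin n → ℚ⁺) λ u → evalP Q (λ i → val (u i)) ≢ 0ℚ

-- the rational function P/Q expresses y in terms of the cluster X:
-- Q(X)·y = P(X) as rational functions in the initial variables.
Expresses : ∀ {n} → Poly n → Poly n → Cluster n → Variable n → Set
Expresses P Q X y =
  ∀ t → evalP Q (λ i → val (X t i)) ℚ.* val (y t) ≡ evalP P (λ i → val (X t i))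

DivBy : ∀ {n} → Fin n → Poly n → Set
DivBy {n} i F = Σ (Poly n) λ G → ∀ (u : Fin n → ℚ⁺) →
  evalP F (λ j → val (u j)) ≡ val (u i) ℚ.* evalP G (λ j → val (u j))

InCluster : ∀ {n} → Cluster n → Variable n → Set
InCluster {n} X y = Σ (Fin n) λ j → ∀ t → val (y t) ≡ val (X t j)

minusUnit : ∀ {n} → Fin n → Fin n → ℤ
minusUnit j i with i ≟ j
... | yes _ = ℤ.- (+ 1)
... | no _  = 0ℤ

IsDVector : ∀ {n} → Cluster n → Variable n → (Fin n → ℤ) → Set
IsDVector {n} X y d =
  (Σ (Fin n) λ j → (∀ t → val (y t) ≡ val (X t j)) × (∀ i → d i ≡ minusUnit j i))
  ⊎
  (¬ InCluster X y ×
   Σ (Poly n) λ F → (∀ i → ¬ DivBy i F) ×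
     (∀ t → val (y t) ℚ.* val (prod⁺ (λ i → pow⁺ (X t i) [ d i ]₊))
            ≡ evalP F (λ i → val (X t i)) ℚ.* val (prod⁺ (λ i → pow⁺ (X t i) [ ℤ.- d i ]₊))))

module Submission where

-- Q_c is acyclic and c_1 is a source; more generally, after mutating at c_1, …, c_{m-1}
-- the vertex c_m is a source. A mutation at a source only reverses the arrows at that
-- vertex, so after the n mutations of c every arrow has been reversed twice and the
-- exchange matrix is B again. The cluster part of these mutations is a bijection φ of
-- the positive points (each exchange is an involution), and mutating further along w
-- from B at φ t gives the cluster of c w at t. Thus X, y at φ t are τX, τy at t, so any
-- identity between them, in particular an expansion or a d-vector, holds for one pair
-- exactly when it holds for the other.

open import Defs
open import Data.Nat using (ℕ)
open import Data.Nat.Base as ℕ using ()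
import Data.Nat.Properties as ℕₚ
open import Data.Integer using (ℤ)
open import Data.Fin using (Fin)
open import Data.List using (List; _++_)
open import Data.Product using (_×_)
open import Function.Bundles using (_⇔_)

open import Data.Bool.Base using (Bool; true; false; _xor_; if_then_else_)
open import Data.Bool.Properties using (T-irrelevant; xor-same; xor-identityʳ; xor-∧-commutativeRing)
open import Data.Fin using (zero; suc; _≟_; _<_; toℕ; fromℕ<; punchOut)
import Data.Fin.Properties as Fin
open import Data.Integer.Base as ℤ using (0ℤ; +_; -[1+_]; +[1+_])
import Data.Integer.Properties as ℤ
open import Data.List.Base using ([]; _∷_; drop; tabulate)
import Data.List.Properties as List
open import Data.Product.Base using (∃; _,_; proj₁; proj₂)
open import Data.Rational.Base as ℚ using (ℚ)
import Data.Rational.Properties as ℚ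
open import Data.Sum.Base using (inj₁; inj₂)
open import Data.Unit.Base using (⊤; tt)
open import Data.Empty using (⊥-elim)
open import Function.Base using (_∘_; case_of_)
open import Function.Bundles using (mk⇔)
open import Function.Definitions using (Injective)
open import Relation.Nullary using (¬_; Dec; yes; no; does)
open import Relation.Nullary.Decidable using (dec-true; dec-false; does-⇔)
open import Relation.Binary.PropositionalEquality
open import Algebra.Bundles using (CommutativeRing)
open import Algebra.Properties.CommutativeSemigroup (CommutativeRing.+-commutativeSemigroup xor-∧-commutativeRing)
  using () renaming (interchange to xor-interchange)

private variable
  n : ℕ
  X X' : Cluster n
  y y' : Variable n

val-injective : {a b : ℚ⁺} → val a ≡ val b → a ≡ b
val-injective {mk⁺ p record { pos = hp }} {mk⁺ .p record { pos = hq }} refl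
  rewrite T-irrelevant hp hq = refl

_/⁺_ : ℚ⁺ → ℚ⁺ → ℚ⁺
a /⁺ b = a *⁺ inv⁺ b

x/[x/y]≡y : (a b : ℚ⁺) → a /⁺ (a /⁺ b) ≡ b
x/[x/y]≡y a@(mk⁺ p _) b@(mk⁺ q hq) =
  val-injective (p/[p/q]≡q {{ℚ.pos⇒nonZero q {{hq}}}} {{ℚ.pos⇒nonZero (val (a /⁺ b)) {{pos (a /⁺ b)}}}})
  where
  open ≡-Reasoning
  p/[p/q]≡q : .{{_ : ℚ.NonZero q}} .{{_ : ℚ.NonZero (p ℚ.* ℚ.1/ q)}} →
              p ℚ.* ℚ.1/ (p ℚ.* ℚ.1/ q) ≡ q
  p/[p/q]≡q = begin
    p ℚ.* ℚ.1/ r            ≡⟨ cong (ℚ._* ℚ.1/ r) p≡q*r ⟩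
    (q ℚ.* r) ℚ.* ℚ.1/ r    ≡⟨ ℚ.*-assoc q r (ℚ.1/ r) ⟩
    q ℚ.* (r ℚ.* ℚ.1/ r)    ≡⟨ cong (q ℚ.*_) (ℚ.*-inverseʳ r) ⟩
    q ℚ.* ℚ.1ℚ              ≡⟨ ℚ.*-identityʳ q ⟩
    q                       ∎
    where
    r = p ℚ.* ℚ.1/ q
    p≡q*r : p ≡ q ℚ.* r
    p≡q*r = sym (begin
      q ℚ.* (p ℚ.* ℚ.1/ q)  ≡⟨ ℚ.*-comm q r ⟩
      (p ℚ.* ℚ.1/ q) ℚ.* q  ≡⟨ ℚ.*-assoc p (ℚ.1/ q) q ⟩
      p ℚ.* (ℚ.1/ q ℚ.* q)  ≡⟨ cong (p ℚ.*_) (ℚ.*-inverseˡ q) ⟩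
      p ℚ.* ℚ.1ℚ            ≡⟨ ℚ.*-identityʳ p ⟩
      p                     ∎)

prod⁺-cong : {f g : Fin n → ℚ⁺} → f ≗ g → prod⁺ f ≡ prod⁺ g
prod⁺-cong {ℕ.zero}  f≗g = refl
prod⁺-cong {ℕ.suc n} f≗g = cong₂ _*⁺_ (f≗g zero) (prod⁺-cong (f≗g ∘ suc))

monomial : (Fin n → ℚ⁺) → (Fin n → ℕ) → ℚ⁺
monomial x e = prod⁺ (λ i → pow⁺ (x i) (e i))

monomial-cong : {x x' : Fin n → ℚ⁺} {e e' : Fin n → ℕ} →
                x ≗ x' → e ≗ e' → monomial x e ≡ monomial x' e'
monomial-cong x≗x' e≗e' = prod⁺-cong (λ i → cong₂ pow⁺ (x≗x' i) (e≗e' i))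

monomial-agree-off : {x x' : Fin n → ℚ⁺} (e : Fin n → ℕ) (k : Fin n) → e k ≡ 0 →
                     (∀ j → j ≢ k → x j ≡ x' j) → monomial x e ≡ monomial x' e
monomial-agree-off {x = x} {x'} e k ek≡0 agree = prod⁺-cong factor
  where
  factor : ∀ i → pow⁺ (x i) (e i) ≡ pow⁺ (x' i) (e i)
  factor i with i ≟ k
  ... | yes refl rewrite ek≡0 = refl
  ... | no i≢k = cong (λ z → pow⁺ z (e i)) (agree i i≢k)

prodℚ-cong : {f g : Fin n → ℚ} → f ≗ g → prodℚ f ≡ prodℚ g
prodℚ-cong {ℕ.zero}  f≗g = refl
prodℚ-cong {ℕ.suc n} f≗g = cong₂ ℚ._*_ (f≗g zero) (prodℚ-cong (f≗g ∘ suc))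

evalP-cong : (P : Poly n) {u v : Fin n → ℚ} → u ≗ v → evalP P u ≡ evalP P v
evalP-cong []             u≗v = refl
evalP-cong ((a , e) ∷ ps) u≗v =
  cong₂ ℚ._+_ (cong ((a ℚ./ 1) ℚ.*_) (prodℚ-cong (λ i → cong (λ z → powℚ z (e i)) (u≗v i))))
              (evalP-cong ps u≗v)

_≈ᴹ_ : Matrix n → Matrix n → Set
M ≈ᴹ M' = ∀ i j → M i j ≡ M' i j

_≈ˢ_ : Seed n → Seed n → Set
s ≈ˢ s' = proj₁ s ≈ᴹ proj₁ s' × proj₂ s ≗ proj₂ s'

exchangeBinomial : Fin n → Matrix n → (Fin n → ℚ⁺) → ℚ⁺
exchangeBinomial k M x = monomial x (λ i → [ M i k ]₊) +⁺ monomial x (λ i → [ ℤ.- M i k ]₊)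

mutCluster-at : (k : Fin n) (M : Matrix n) (x : Fin n → ℚ⁺) →
                mutCluster k M x k ≡ exchangeBinomial k M x /⁺ x k
mutCluster-at k M x with k ≟ k
... | yes _   = refl
... | no k≢k = ⊥-elim (k≢k refl)

mutCluster-off : {k j : Fin n} (M : Matrix n) (x : Fin n → ℚ⁺) → j ≢ k → mutCluster k M x j ≡ x j
mutCluster-off {k = k} {j} M x j≢k with j ≟ k
... | yes j≡k = ⊥-elim (j≢k j≡k)
... | no _    = refl

exchangeBinomial-agree-off : (k : Fin n) {M : Matrix n} {x x' : Fin n → ℚ⁺} → M k k ≡ 0ℤ →
  (∀ j → j ≢ k → x j ≡ x' j) → exchangeBinomial k M x ≡ exchangeBinomial k M x'
exchangeBinomial-agree-off k {M} Mkk≡0 agree = cong₂ _+⁺_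
  (monomial-agree-off (λ i → [ M i k ]₊) k (cong [_]₊ Mkk≡0) agree)
  (monomial-agree-off (λ i → [ ℤ.- M i k ]₊) k (cong (λ z → [ ℤ.- z ]₊) Mkk≡0) agree)

-- The exchange binomial at k does not involve x k.
mutCluster-involutive : (k : Fin n) (M : Matrix n) (x : Fin n → ℚ⁺) → M k k ≡ 0ℤ →
                        mutCluster k M (mutCluster k M x) ≗ x
mutCluster-involutive k M x Mkk≡0 j = case j ≟ k of λ where
    (no j≢k)  → trans (mutCluster-off M x′ j≢k) (mutCluster-off M x j≢k)
    (yes refl) → begin
      mutCluster k M x′ k                 ≡⟨ mutCluster-at k M x′ ⟩
      exchangeBinomial k M x′ /⁺ x′ k     ≡⟨ cong₂ _/⁺_ E′≡E (mutCluster-at k M x) ⟩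
      E /⁺ (E /⁺ x k)                     ≡⟨ x/[x/y]≡y E (x k) ⟩
      x k                                 ∎
  where
  open ≡-Reasoning
  x′ = mutCluster k M x
  E  = exchangeBinomial k M x
  E′≡E : exchangeBinomial k M x′ ≡ E
  E′≡E = exchangeBinomial-agree-off k {M} Mkk≡0 (λ i i≢k → mutCluster-off M x i≢k)

mutMatrix-cong : (k : Fin n) {M M' : Matrix n} → M ≈ᴹ M' → mutMatrix k M ≈ᴹ mutMatrix k M'
mutMatrix-cong k M≈M' i j with i ≟ k | j ≟ k
... | yes _ | _     = cong ℤ.-_ (M≈M' i j)
... | no _  | yes _ = cong ℤ.-_ (M≈M' i j)
... | no _  | no _  rewrite M≈M' i j | M≈M' i k | M≈M' k j = refl

mutCluster-cong : (k : Fin n) {M M' : Matrix n} {x x' : Fin n → ℚ⁺} →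
                  M ≈ᴹ M' → x ≗ x' → mutCluster k M x ≗ mutCluster k M' x'
mutCluster-cong k M≈M' x≗x' j with j ≟ k
... | yes _ = cong₂ _/⁺_
  (cong₂ _+⁺_ (monomial-cong x≗x' (λ i → cong [_]₊ (M≈M' i k)))
              (monomial-cong x≗x' (λ i → cong (λ z → [ ℤ.- z ]₊) (M≈M' i k))))
  (x≗x' k)
... | no _  = x≗x' j

mutSeq-cong : (ks : List (Fin n)) {s s' : Seed n} → s ≈ˢ s' → mutSeq ks s ≈ˢ mutSeq ks s'
mutSeq-cong []       s≈s'           = s≈s'
mutSeq-cong (k ∷ ks) (M≈M' , x≗x') =
  mutSeq-cong ks (mutMatrix-cong k M≈M' , mutCluster-cong k M≈M' x≗x')

mutSeq-++ : (ks ls : List (Fin n)) (s : Seed n) → mutSeq (ks ++ ls) s ≡ mutSeq ls (mutSeq ks s)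
mutSeq-++ []       ls s = refl
mutSeq-++ (k ∷ ks) ls s = mutSeq-++ ks ls (mutSeed k s)

mutMatrixSeq : List (Fin n) → Matrix n → Matrix n
mutMatrixSeq []       M = M
mutMatrixSeq (k ∷ ks) M = mutMatrixSeq ks (mutMatrix k M)

proj₁-mutSeq : (ks : List (Fin n)) (M : Matrix n) (x : Fin n → ℚ⁺) →
               proj₁ (mutSeq ks (M , x)) ≡ mutMatrixSeq ks M
proj₁-mutSeq []       M x = refl
proj₁-mutSeq (k ∷ ks) M x = proj₁-mutSeq ks (mutMatrix k M) (mutCluster k M x)

LoopFreeAlong : List (Fin n) → Matrix n → Set
LoopFreeAlong []       M = ⊤
LoopFreeAlong (k ∷ ks) M = M k k ≡ 0ℤ × LoopFreeAlong ks (mutMatrix k M)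

mutSeq-surjective : (ks : List (Fin n)) (M : Matrix n) → LoopFreeAlong ks M →
                    ∀ x' → ∃ λ x → proj₂ (mutSeq ks (M , x)) ≗ x'
mutSeq-surjective []       M _                   x' = x' , λ _ → refl
mutSeq-surjective (k ∷ ks) M (Mkk≡0 , loopFree) x'
  with y , hits ← mutSeq-surjective ks (mutMatrix k M) loopFree x' =
  mutCluster k M y , λ i → trans
    (proj₂ (mutSeq-cong ks ((λ _ _ → refl) , mutCluster-involutive k M y Mkk≡0)) i)
    (hits i)

SameExpansions : Cluster n → Variable n → Cluster n → Variable n → Set
SameExpansions {n} X y X' y' =
  ((P Q : Poly n) → NonzeroPoly Q → Expresses P Q X y ⇔ Expresses P Q X' y')
  × ((d : Fin n → ℤ) → IsDVector X y d ⇔ IsDVector X' y' d)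

record Matches (X : Cluster n) (y : Variable n) (X' : Cluster n) (y' : Variable n)
               (t s : Fin n → ℚ⁺) : Set where
  constructor matches
  field
    clusters  : X' t ≗ X s
    variables : y' t ≡ y s

record Reparametrisation (X : Cluster n) (y : Variable n) (X' : Cluster n) (y' : Variable n) : Set where
  field
    forth : ∀ t → ∃ λ s → Matches X y X' y' t s
    back  : ∀ s → ∃ λ t → Matches X y X' y' t s

Matches-sym : ∀ {t s} → Matches X y X' y' t s → Matches X' y' X y s t
Matches-sym (matches X't≗Xs y't≡ys) = matches (sym ∘ X't≗Xs) (sym y't≡ys)

Reparametrisation-sym : Reparametrisation X y X' y' → Reparametrisation X' y' X y
Reparametrisation-sym r = record
  { forth = λ s → let t , m = back s in t , Matches-sym m
  ; back  = λ t → let s , m = forth t in s , Matches-sym m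
  }
  where open Reparametrisation r

InCluster-transfer : (∀ t → ∃ λ s → Matches X y X' y' t s) → ∀ j →
  (∀ s → val (y s) ≡ val (X s j)) → ∀ t → val (y' t) ≡ val (X' t j)
InCluster-transfer forth j y≡Xj t with s , matches X't≗Xs y't≡ys ← forth t =
  trans (cong val y't≡ys) (trans (y≡Xj s) (cong val (sym (X't≗Xs j))))

Expresses-transfer : {X X' : Cluster n} {y y' : Variable n} →
                     (∀ t → ∃ λ s → Matches X y X' y' t s) →
                     ∀ P Q → Expresses P Q X y → Expresses P Q X' y'
Expresses-transfer {X = X} {X'} {y} {y'} forth P Q QX*y≡PX t
  with s , matches X't≗Xs y't≡ys ← forth t = begin
  evalP Q (λ i → val (X' t i)) ℚ.* val (y' t) ≡⟨ cong₂ ℚ._*_ (evalP-cong Q X't≗Xs′) (cong val y't≡ys) ⟩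
  evalP Q (λ i → val (X s i)) ℚ.* val (y s)   ≡⟨ QX*y≡PX s ⟩
  evalP P (λ i → val (X s i))                 ≡⟨ evalP-cong P X't≗Xs′ ⟨
  evalP P (λ i → val (X' t i))                ∎
  where
  open ≡-Reasoning
  X't≗Xs′ : (λ i → val (X' t i)) ≗ (λ i → val (X s i))
  X't≗Xs′ i = cong val (X't≗Xs i)

IsDVector-transfer : {X X' : Cluster n} {y y' : Variable n} → Reparametrisation X y X' y' →
                     ∀ d → IsDVector X y d → IsDVector X' y' d
IsDVector-transfer r d (inj₁ (j , y≡Xj , d≡-eⱼ)) = inj₁ (j , InCluster-transfer forth j y≡Xj , d≡-eⱼ)
  where open Reparametrisation r
IsDVector-transfer {X = X} {X'} {y} {y'} r d (inj₂ (y∉X , F , F-reduced , y≡F/xᵈ)) =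
  inj₂ (y'∉X' , F , F-reduced , y'≡F/xᵈ)
  where
  open Reparametrisation r
  y'∉X' : ¬ InCluster X' y'
  y'∉X' (j , y'≡X'j) =
    y∉X (j , InCluster-transfer (Reparametrisation.forth (Reparametrisation-sym r)) j y'≡X'j)
  y'≡F/xᵈ : ∀ t → val (y' t) ℚ.* val (monomial (X' t) (λ i → [ d i ]₊))
                 ≡ evalP F (λ i → val (X' t i)) ℚ.* val (monomial (X' t) (λ i → [ ℤ.- d i ]₊))
  y'≡F/xᵈ t with s , matches X't≗Xs y't≡ys ← forth t = begin
    val (y' t) ℚ.* val (monomial (X' t) _)
      ≡⟨ cong₂ ℚ._*_ (cong val y't≡ys) (xᵉ-cong _) ⟩
    val (y s) ℚ.* val (monomial (X s) _)
      ≡⟨ y≡F/xᵈ s ⟩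
    evalP F (λ i → val (X s i)) ℚ.* val (monomial (X s) _)
      ≡⟨ cong₂ ℚ._*_ (evalP-cong F (cong val ∘ X't≗Xs)) (xᵉ-cong _) ⟨
    evalP F (λ i → val (X' t i)) ℚ.* val (monomial (X' t) _)
      ∎
    where
    open ≡-Reasoning
    xᵉ-cong : ∀ e → val (monomial (X' t) e) ≡ val (monomial (X s) e)
    xᵉ-cong e = cong val (monomial-cong X't≗Xs (λ _ → refl))

reparametrisation⇒sameExpansions : Reparametrisation X y X' y' → SameExpansions X y X' y'
reparametrisation⇒sameExpansions r =
  (λ P Q _ → mk⇔ (Expresses-transfer forth P Q)
                  (Expresses-transfer (Reparametrisation.forth r⁻¹) P Q)) ,
  (λ d → mk⇔ (IsDVector-transfer r d) (IsDVector-transfer r⁻¹ d))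
  where
  open Reparametrisation r
  r⁻¹ = Reparametrisation-sym r

module _ (B : Matrix n) (ks : List (Fin n))
         (ks-fixes-B : mutMatrixSeq ks B ≈ᴹ B) (loopFree : LoopFreeAlong ks B) where

  private
    φ : (Fin n → ℚ⁺) → Fin n → ℚ⁺
    φ t = proj₂ (mutSeq ks (B , t))

    clusterOf-cong : ∀ u {t t'} → t ≗ t' → clusterOf B u t ≗ clusterOf B u t'
    clusterOf-cong u t≗t' = proj₂ (mutSeq-cong u ((λ _ _ → refl) , t≗t'))

    clusterOf-++ : ∀ u t → clusterOf B (ks ++ u) t ≗ clusterOf B u (φ t)
    clusterOf-++ u t i = trans (cong (λ s → proj₂ s i) (mutSeq-++ ks u (B , t)))
                               (proj₂ (mutSeq-cong u (matrix≈B , λ _ → refl)) i)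
      where
      matrix≈B : proj₁ (mutSeq ks (B , t)) ≈ᴹ B
      matrix≈B a b = trans (cong (λ M → M a b) (proj₁-mutSeq ks B t)) (ks-fixes-B a b)

  period-reparametrisation : ∀ w v i →
    Reparametrisation (clusterOf B w) (λ t → clusterOf B v t i)
                      (clusterOf B (ks ++ w)) (λ t → clusterOf B (ks ++ v) t i)
  period-reparametrisation w v i = record
    { forth = λ t → φ t , matches (clusterOf-++ w t) (clusterOf-++ v t i)
    ; back  = λ s → let t , φt≗s = mutSeq-surjective ks B loopFree s in
        t , matches (λ j → trans (clusterOf-++ w t j) (clusterOf-cong w φt≗s j))
                    (trans (clusterOf-++ v t i) (clusterOf-cong v φt≗s i))
    }

negateIf : Bool → ℤ → ℤ
negateIf b z = if b then ℤ.- z else z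

negateIf-xor : ∀ a b z → negateIf (a xor b) z ≡ negateIf a (negateIf b z)
negateIf-xor false b     z = refl
negateIf-xor true  false z = refl
negateIf-xor true  true  z = sym (ℤ.neg-involutive z)

flipAt : Fin n → Matrix n → Matrix n
flipAt k M i j = negateIf (does (i ≟ k) xor does (j ≟ k)) (M i j)

IsSource : Fin n → Matrix n → Set
IsSource k M = ∀ j → j ≢ k → 0ℤ ℤ.≤ M k j × M j k ℤ.≤ 0ℤ

nonPositive⇒[z]₊≡0 : ∀ {z} → z ℤ.≤ 0ℤ → [ z ]₊ ≡ 0
nonPositive⇒[z]₊≡0 {+ 0}      _          = refl
nonPositive⇒[z]₊≡0 { -[1+ _ ] } _         = refl
nonPositive⇒[z]₊≡0 {+[1+ _ ]} (ℤ.+≤+ ())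

nonNegative⇒[-z]₊≡0 : ∀ {z} → 0ℤ ℤ.≤ z → [ ℤ.- z ]₊ ≡ 0
nonNegative⇒[-z]₊≡0 0≤z = nonPositive⇒[z]₊≡0 (ℤ.neg-mono-≤ 0≤z)

mutMatrix-source : (k : Fin n) (M : Matrix n) → M k k ≡ 0ℤ → IsSource k M → mutMatrix k M ≈ᴹ flipAt k M
mutMatrix-source k M Mkk≡0 source i j with i ≟ k | j ≟ k
... | yes refl | yes refl rewrite Mkk≡0 = refl
... | yes refl | no _     = refl
... | no _     | yes refl = refl
... | no i≢k   | no j≢k
  rewrite nonPositive⇒[z]₊≡0 (proj₂ (source i i≢k)) | nonNegative⇒[-z]₊≡0 (proj₁ (source j j≢k))
        | ℤ.*-zeroʳ (+ [ ℤ.- M i k ]₊) = trans (ℤ.+-identityʳ (M i j ℤ.+ 0ℤ)) (ℤ.+-identityʳ (M i j))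

injective⇒surjective : (f : Fin n → Fin n) → Injective _≡_ _≡_ f → ∀ i → ∃ λ l → f l ≡ i
injective⇒surjective {ℕ.suc m} f f-injective i with Fin.any? (λ l → f l ≟ i)
... | yes hit = hit
... | no miss = ⊥-elim (ℕₚ.1+n≰n (Fin.injective⇒≤ g-injective))
  where
  i≢f : ∀ l → i ≢ f l
  i≢f l i≡fl = miss (l , sym i≡fl)
  g : Fin (ℕ.suc m) → Fin m
  g l = punchOut (i≢f l)
  g-injective : Injective _≡_ _≡_ g
  g-injective {l} {l'} gl≡gl' = f-injective (Fin.punchOut-injective (i≢f l) (i≢f l') gl≡gl')

drop-tabulate : {A : Set} (g : Fin n → A) (l : Fin n) →
                drop (toℕ l) (tabulate g) ≡ g l ∷ drop (ℕ.suc (toℕ l)) (tabulate g)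
drop-tabulate g zero    = refl
drop-tabulate g (suc l) = drop-tabulate (g ∘ suc) l

drop-all-tabulate : {A : Set} (g : Fin n → A) → drop n (tabulate g) ≡ []
drop-all-tabulate g = List.drop-all _ (tabulate g) (ℕₚ.≤-reflexive (List.length-tabulate g))

<-suc-xor : ∀ x m → does (x ℕₚ.<? ℕ.suc m) ≡ does (x ℕₚ.≟ m) xor does (x ℕₚ.<? m)
<-suc-xor ℕ.zero    ℕ.zero    = refl
<-suc-xor ℕ.zero    (ℕ.suc m) = refl
<-suc-xor (ℕ.suc x) ℕ.zero    = refl
<-suc-xor (ℕ.suc x) (ℕ.suc m) = <-suc-xor x m

-- Of the finite-type hypotheses only the sign of the off-diagonal Cartan entries is used.
-- quiverAfter m is Q_c with the arrows between c_1, …, c_m and the other vertices reversed.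
module CoxeterSequence (A : Matrix n) (offdiag : ∀ i j → i ≢ j → A i j ℤ.≤ 0ℤ)
                       (c : Fin n → Fin n) (c-injective : IsCoxeterWord c)
                       (B : Matrix n) (B-quiver : IsQuiverQc A c B) where

  position : Fin n → Fin n
  position i = proj₁ (injective⇒surjective c c-injective i)

  c∘position : ∀ i → c (position i) ≡ i
  c∘position i = proj₂ (injective⇒surjective c c-injective i)

  position∘c : ∀ l → position (c l) ≡ l
  position∘c l = c-injective (c∘position (c l))

  quiver-arrow : ∀ {i j} → position i < position j → B i j ≡ ℤ.- A i j × B j i ≡ A j i
  quiver-arrow {i} {j} p<q = subst₂ (λ i j → B i j ≡ ℤ.- A i j × B j i ≡ A j i)
                             (c∘position i) (c∘position j) (proj₂ B-quiver (position i) (position j) p<q)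

  visited : ℕ → Fin n → Bool
  visited m i = does (toℕ (position i) ℕₚ.<? m)

  quiverAfter : ℕ → Matrix n
  quiverAfter m i j = negateIf (visited m i xor visited m j) (B i j)

  module Step (l : Fin n) where

    k : Fin n
    k = c l

    visited-k : visited (toℕ l) k ≡ false
    visited-k = dec-false (_ ℕₚ.<? _) (λ p<l → ℕₚ.<-irrefl (cong toℕ (position∘c l)) p<l)

    visited-suc : ∀ i → visited (ℕ.suc (toℕ l)) i ≡ does (i ≟ k) xor visited (toℕ l) i
    visited-suc i = trans (<-suc-xor (toℕ (position i)) (toℕ l))
                          (cong (_xor visited (toℕ l) i) (does-⇔ at-l⇔≡k (_ ℕₚ.≟ _) (i ≟ k)))
      where
      at-l⇔≡k : toℕ (position i) ≡ toℕ l ⇔ i ≡ k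
      at-l⇔≡k = mk⇔ (λ p≡l → trans (sym (c∘position i)) (cong c (Fin.toℕ-injective p≡l)))
                    (λ i≡k → cong toℕ (trans (cong position i≡k) (position∘c l)))

    arrows-at-k : ∀ j → j ≢ k → (visited? : Dec (toℕ (position j) ℕ.< toℕ l)) →
      negateIf (does visited?) (B k j) ≡ ℤ.- A k j × negateIf (does visited?) (B j k) ≡ A j k
    arrows-at-k j j≢k (yes p<l)
      with Bjk≡-Ajk , Bkj≡Akj ← quiver-arrow {j} {k} (subst (_ ℕ.<_) (sym (cong toℕ (position∘c l))) p<l)
      rewrite Bjk≡-Ajk | Bkj≡Akj = refl , ℤ.neg-involutive (A j k)
    arrows-at-k j j≢k (no p≮l) = quiver-arrow {k} {j} l<p
      where
      l<p : position k < position j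
      l<p rewrite position∘c l = ℕₚ.≤∧≢⇒< (ℕₚ.≮⇒≥ p≮l)
        (λ l≡p → j≢k (trans (sym (c∘position j)) (cong c (Fin.toℕ-injective (sym l≡p)))))

    loop-free : quiverAfter (toℕ l) k k ≡ 0ℤ
    loop-free = trans (cong (λ b → negateIf b (B k k)) (xor-same (visited (toℕ l) k))) (proj₁ B-quiver k)

    row : ∀ j → j ≢ k → quiverAfter (toℕ l) k j ≡ ℤ.- A k j
    row j j≢k = trans (cong (λ b → negateIf (b xor visited (toℕ l) j) (B k j)) visited-k)
                      (proj₁ (arrows-at-k j j≢k (_ ℕₚ.<? _)))

    column : ∀ j → j ≢ k → quiverAfter (toℕ l) j k ≡ A j k
    column j j≢k = trans (cong (λ b → negateIf b (B j k))
                                (trans (cong (visited (toℕ l) j xor_) visited-k) (xor-identityʳ _)))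
                         (proj₂ (arrows-at-k j j≢k (_ ℕₚ.<? _)))

    source : IsSource k (quiverAfter (toℕ l))
    source j j≢k = subst (0ℤ ℤ.≤_) (sym (row j j≢k)) (ℤ.neg-mono-≤ (offdiag k j (j≢k ∘ sym))) ,
                   subst (ℤ._≤ 0ℤ) (sym (column j j≢k)) (offdiag j k j≢k)

    step : mutMatrix k (quiverAfter (toℕ l)) ≈ᴹ quiverAfter (ℕ.suc (toℕ l))
    step i j = begin
      mutMatrix k (quiverAfter m) i j
        ≡⟨ mutMatrix-source k (quiverAfter m) loop-free source i j ⟩
      negateIf (does (i ≟ k) xor does (j ≟ k)) (negateIf (visited m i xor visited m j) (B i j))
        ≡⟨ negateIf-xor (does (i ≟ k) xor does (j ≟ k)) (visited m i xor visited m j) (B i j) ⟨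
      negateIf ((does (i ≟ k) xor does (j ≟ k)) xor (visited m i xor visited m j)) (B i j)
        ≡⟨ cong (λ b → negateIf b (B i j)) (xor-interchange (does (i ≟ k)) _ _ _) ⟩
      negateIf ((does (i ≟ k) xor visited m i) xor (does (j ≟ k) xor visited m j)) (B i j)
        ≡⟨ cong₂ (λ a b → negateIf (a xor b) (B i j)) (visited-suc i) (visited-suc j) ⟨
      quiverAfter (ℕ.suc m) i j
        ∎
      where
      open ≡-Reasoning
      m = toℕ l

  quiverAfter-all : quiverAfter n ≈ᴹ B
  quiverAfter-all i j = cong (λ b → negateIf b (B i j)) (cong₂ _xor_ (visited-all i) (visited-all j))
    where
    visited-all : ∀ i → visited n i ≡ true
    visited-all i = dec-true (_ ℕₚ.<? _) (Fin.toℕ<n (position i))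

  ReturnsToB : ℕ → Set
  ReturnsToB m = ∀ M → M ≈ᴹ quiverAfter m →
    LoopFreeAlong (drop m (coxList c)) M × mutMatrixSeq (drop m (coxList c)) M ≈ᴹ B

  returnsToB-all : ReturnsToB n
  returnsToB-all M M≈ rewrite drop-all-tabulate c = tt , λ i j → trans (M≈ i j) (quiverAfter-all i j)

  returnsToB-step : ∀ l → ReturnsToB (ℕ.suc (toℕ l)) → ReturnsToB (toℕ l)
  returnsToB-step l next M M≈ rewrite drop-tabulate c l =
    (trans (M≈ k k) loop-free , proj₁ rest) , proj₂ rest
    where
    open Step l
    rest = next (mutMatrix k M) (λ i j → trans (mutMatrix-cong k M≈ i j) (step i j))

  returnsToB : ∀ r m → r ℕ.+ m ≡ n → ReturnsToB m
  returnsToB ℕ.zero    m refl = returnsToB-all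
  returnsToB (ℕ.suc r) m 1+r+m≡n = subst ReturnsToB (Fin.toℕ-fromℕ< m<n)
    (returnsToB-step l (subst ReturnsToB (cong ℕ.suc (sym (Fin.toℕ-fromℕ< m<n)))
                                      (returnsToB r (ℕ.suc m) (trans (ℕₚ.+-suc r m) 1+r+m≡n))))
    where
    m<n : m ℕ.< n
    m<n = subst (m ℕ.<_) 1+r+m≡n (ℕ.s≤s (ℕₚ.m≤n+m m r))
    l = fromℕ< m<n

  coxeter-sequence : LoopFreeAlong (coxList c) B × mutMatrixSeq (coxList c) B ≈ᴹ B
  coxeter-sequence = returnsToB n 0 (ℕₚ.+-identityʳ n) B (λ _ _ → refl)

lemma6p1 : (n : ℕ) (A : Fin n → Fin n → ℤ) → FiniteTypeCartan n A →
           (c : Fin n → Fin n) → IsCoxeterWord c →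
           (B : Fin n → Fin n → ℤ) → IsQuiverQc A c B →
           (w v : List (Fin n)) (i : Fin n) →
           ((P Q : Poly n) → NonzeroPoly Q →
             Expresses P Q (clusterOf B w) (λ t → clusterOf B v t i)
             ⇔ Expresses P Q (clusterOf B (coxList c ++ w))
                 (λ t → clusterOf B (coxList c ++ v) t i))
           ×
           ((d : Fin n → ℤ) →
             IsDVector (clusterOf B w) (λ t → clusterOf B v t i) d
             ⇔ IsDVector (clusterOf B (coxList c ++ w))
                 (λ t → clusterOf B (coxList c ++ v) t i) d)
lemma6p1 n A cartan c c-injective B B-quiver w v i =
  reparametrisation⇒sameExpansions
    (period-reparametrisation B (coxList c) (proj₂ coxeter-sequence) (proj₁ coxeter-sequence) w v i)
  where
  open CoxeterSequence A (FiniteTypeCartan.offdiag cartan) c c-injective B B-quiver
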